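{- Let $G$ be a graph and $uv\in E(G)$. Let $W_1=N(u)\setminus N[v]$, $W_2=N(u)\cap N(v)$, $W_3=N(v)\setminus N[u]$ and $W_4=V(G)\setminus (N[u]\cup N[v])$. Suppose that there is no maximal induced matching $M$ of $G$ with $V(M)\subseteq W_1\cup W_4$ and $V(M)\cap W_1\ne\emptyset$, and there is no maximal induced matching $M$ of $G$ with $V(M)\subseteq W_3\cup W_4$ and $V(M)\cap W_3\ne\emptyset$. Then $|M_{G_{u\rightarrow v}}|\ge |M_G|$ or $|M_{G_{v\rightarrow u}}|\ge |M_G|$.
   Context: Graphs are finite and simple. $N(x)$ and $N[x]$ are the open and closed neighbourhoods of $x$. An induced matching is a matching whose endpoints induce a $1$-regular subgraph; it is maximal if not properly contained in another induced matching. $V(M)$ is the set of vertices covered by $M$, and $|M_H|$ denotes the number of maximal induced matchings of a graph $H$. For $uv\in E(G)$, $G_{v\rightarrow u}$ is the graph obtained from $G$ by deleting the edge $vx$ for every $x\in N(v)\setminus N[u]$ and adding the edge $vy$ for every $y\in N(u)\setminus N[v]$ (so that $v$ becomes a twin of $u$, i.e. $N[v]=N[u]$); $G_{u\rightarrow v}$ is defined symmetrically. -}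

module Defs where

open import Data.Nat using (ℕ; zero; suc; _≥_)
open import Data.Bool using (Bool; true; false; _∧_; _∨_; not; if_then_else_)
open import Data.Fin using (Fin; _≟_)
open import Data.Vec using (Vec; []; _∷_; lookup)
open import Data.List using (List; []; _∷_; concatMap; map; filter; length; allFin)
open import Data.Bool.ListAction using (all; any)
open import Data.Bool.Properties using (T?)
open import Relation.Nullary.Decidable using (⌊_⌋)
open import Relation.Binary.PropositionalEquality using (_≡_)

Adj : ℕ → Set
Adj n = Fin n → Fin n → Bool

record IsSimple {n : ℕ} (A : Adj n) : Set where
  field
    sym   : ∀ x y → A x y ≡ A y x
    irrfl : ∀ x → A x x ≡ false

_==_ : {n : ℕ} → Fin n → Fin n → Bool
x == y = ⌊ x ≟ y ⌋

inClosedN : {n : ℕ} → Adj n → Fin n → Fin n → Bool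
inClosedN A u x = (x == u) ∨ A u x

-- Edge subsets: a set of edges of a graph on Fin n is represented by an
-- n×n Boolean matrix which must be symmetric and contained in E(G)
-- (see isEdgeSubset).  Each edge subset corresponds to exactly one
-- such matrix.

EdgeSet : ℕ → Set
EdgeSet n = Vec (Vec Bool n) n

mem : {n : ℕ} → EdgeSet n → Fin n → Fin n → Bool
mem M x y = lookup (lookup M x) y

allVecs : {A : Set} → (k : ℕ) → List A → List (Vec A k)
allVecs zero    xs = [] ∷ []
allVecs (suc k) xs = concatMap (λ a → map (a ∷_) (allVecs k xs)) xs

allEdgeSets : (n : ℕ) → List (EdgeSet n)
allEdgeSets n = allVecs n (allVecs n (true ∷ false ∷ []))

module _ {n : ℕ} (A : Adj n) where

  vs : List (Fin n)
  vs = allFin n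

  isEdgeSubset : EdgeSet n → Bool
  isEdgeSubset M =
    all (λ x → all (λ y → ((mem M x y ==ᵇ mem M y x) ∧ (not (mem M x y) ∨ A x y))) vs) vs
    where
      _==ᵇ_ : Bool → Bool → Bool
      true  ==ᵇ b = b
      false ==ᵇ b = not b

  inV : EdgeSet n → Fin n → Bool
  inV M x = any (λ y → mem M x y) vs

  exactlyOne : List Bool → Bool
  exactlyOne []          = false
  exactlyOne (true ∷ bs) = all not bs
  exactlyOne (false ∷ bs) = exactlyOne bs

  -- M is an induced matching: M ⊆ E(G) and G[V(M)] is 1-regular
  -- (every vertex of V(M) has exactly one neighbour in V(M))
  isInducedMatching : EdgeSet n → Bool
  isInducedMatching M =
    isEdgeSubset M ∧
    all (λ x → not (inV M x) ∨ exactlyOne (map (λ y → inV M y ∧ A x y) vs)) vs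

  subsetEq : EdgeSet n → EdgeSet n → Bool
  subsetEq M M' = all (λ x → all (λ y → not (mem M x y) ∨ mem M' x y) vs) vs

  properSubset : EdgeSet n → EdgeSet n → Bool
  properSubset M M' = subsetEq M M' ∧ not (subsetEq M' M)

  isMaximalInducedMatching : EdgeSet n → Bool
  isMaximalInducedMatching M =
    isInducedMatching M ∧
    all (λ M' → not (isInducedMatching M' ∧ properSubset M M')) (allEdgeSets n)

numMIM : {n : ℕ} → Adj n → ℕ
numMIM {n} A = length (filter (λ M → T? (isMaximalInducedMatching A M)) (allEdgeSets n))

-- G_{v→u}: delete vx for every x ∈ N(v) ∖ N[u], add vy for every
-- y ∈ N(u) ∖ N[v]; all other adjacencies unchanged.

newVAdj : {n : ℕ} → Adj n → (v u x : Fin n) → Bool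
newVAdj A v u x =
  if A v x ∧ not (inClosedN A u x) then false
  else if A u x ∧ not (inClosedN A v x) then true
  else A v x

shift : {n : ℕ} → Adj n → (v u : Fin n) → Adj n
shift A v u a b =
  if a == b then A a b
  else if a == v then newVAdj A v u b
  else if b == v then newVAdj A v u a
  else A a b

-- notation: G_{v→u} = shift A v u

-- In B = G_{u→v} the vertices u and v are twins. Sort the maximal induced matchings M of G by
-- how V(M) meets {u, v}, and map each class injectively into the maximal induced matchings of B:
--  * if u ∉ V(M), then M itself is maximal in B. An induced matching of B extending M through u
--    matches u with some y; then V(M) misses N[v] and the neighbours of y, so either V(M) lies in
--    W₁ ∪ W₄ and meets W₁ (excluded by hypothesis), or M + uv resp. M + vy is a larger induced
--    matching of G;
--  * if u, v ∈ V(M), then uv ∈ M and M is still induced in B; send M to a maximal extension.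
--    This is injective: two such matchings inside one induced matching of B form together an
--    induced matching of G, so by maximality they coincide;
--  * if v ∈ V(M) but u ∉ V(M), then M is maximal in B by the first case, and the transposition
--    of the twins u, v carries it to a maximal induced matching of B covering u but not v.
-- The images are disjoint, so |M_B| ≥ #(u ∉) + #(u, v ∈) + #(v ∈, u ∉). Adding the same bound
-- for G_{v→u} gives |M_{G_{u→v}}| + |M_{G_{v→u}}| ≥ 2 |M_G|.

module Submission where

open import Defs
open import Data.Bool using (Bool; true; false; _∧_; _∨_; not)
open import Data.Bool.Properties using (T-≡; T?; ∧-comm; ∨-comm; ∨-zeroʳ; ¬-not; not-involutive)
open import Data.Bool.ListAction using (all; any)
open import Data.Empty using (⊥)
open import Data.Fin using (Fin; _≟_; combine)
open import Data.Fin.Properties using (combine-surjective; any?)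
open import Data.Fin.Subset using (_⊆_; _⊂_; _⊃_)
open import Data.Fin.Subset.Induction using (⊃-wellFounded)
open import Data.Fin.Permutation.Components using (transpose)
open import Data.List using (List; []; _∷_; _++_; length; filter; map; concatMap; allFin; cartesianProductWith)
open import Data.List.Properties using (length-++)
open import Data.List.Membership.Propositional using (_∈_; find; lose)
open import Data.List.Membership.Propositional.Properties using (∈-allFin; ∈-map⁺; ∈-map⁻; ∈-cartesianProductWith⁺; ∈-filter⁺; ∈-filter⁻; ∈-∃++; ∈-++⁻; ∈-++⁺ˡ; ∈-++⁺ʳ)
open import Data.List.Relation.Unary.All as All using ([]; _∷_)
open import Data.List.Relation.Unary.All.Properties using (all⁺; all⁻)
open import Data.List.Relation.Unary.Any using (here; there)
open import Data.List.Relation.Unary.Any.Properties using (any⁺; any⁻)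
open import Data.List.Relation.Unary.Unique.Propositional using (Unique)
open import Data.List.Relation.Unary.AllPairs using ([]; _∷_)
open import Data.List.Relation.Unary.Unique.Propositional.Properties using (allFin⁺; cartesianProductWith⁺; filter⁺)
open import Data.Nat using (ℕ; zero; suc; _≥_; _≤_; _+_; z≤n; s≤s; _≤?_)
open import Data.Nat.Tactic.RingSolver using (solve-∀)
import Data.Nat.Properties as ℕ
open import Data.Vec using (Vec; []; _∷_; lookup; tabulate; concat)
import Data.Bool.Properties as Bool
import Data.Vec.Properties as Vec
open import Data.Vec.Properties using (lookup∘tabulate; lookup-concat; lookup⇒[]=; []=⇒lookup)
open import Data.Vec.Relation.Binary.Pointwise.Extensional using (ext; Pointwise-≡⇒≡)
open import Data.Product using (∃; ∃₂; _×_; _,_; proj₁; proj₂)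
open import Data.Sum using (_⊎_; inj₁; inj₂; [_,_])
import Data.Sum as Sum
open import Induction.WellFounded using (WellFounded; Acc; acc; module Subrelation)
import Relation.Binary.Construct.On as On
open import Function using (_∘_; id; _on_; Equivalence)
open import Relation.Nullary using (¬_; yes; no; contradiction)
open import Relation.Nullary.Decidable using (toSum; toWitness; dec-true; dec-false; isYes≗does)
open import Relation.Binary.PropositionalEquality using (_≡_; _≢_; refl; sym; trans; cong; cong₂; subst)

open Equivalence using (to; from)

∧-true⁻ : ∀ {a b} → a ∧ b ≡ true → a ≡ true × b ≡ true
∧-true⁻ {true} b≡true = refl , b≡true

∨-true⁻ : ∀ {a b} → a ∨ b ≡ true → a ≡ true ⊎ b ≡ true
∨-true⁻ {true}  _        = inj₁ refl
∨-true⁻ {false} b≡true = inj₂ b≡true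

∨-false⁻ : ∀ {a b} → a ∨ b ≡ false → a ≡ false × b ≡ false
∨-false⁻ {false} b≡false = refl , b≡false

true≢false : ∀ {a} → a ≡ true → a ≢ false
true≢false refl ()

not-true⁻ : ∀ {a} → not a ≡ true → a ≡ false
not-true⁻ {false} _ = refl

not∨-true⁻ : ∀ {a b} → a ≡ true → not a ∨ b ≡ true → b ≡ true
not∨-true⁻ refl b≡true = b≡true

true⇔true⇒≡ : ∀ {a b} → (a ≡ true → b ≡ true) → (b ≡ true → a ≡ true) → a ≡ b
true⇔true⇒≡ {true}  a⇒b _ = sym (a⇒b refl)
true⇔true⇒≡ {false} {false} _ _ = refl
true⇔true⇒≡ {false} {true} _ b⇒a = b⇒a refl

module _ {X : Set} (p : X → Bool) where

  all-true⁻ : ∀ {xs} → all p xs ≡ true → ∀ {x} → x ∈ xs → p x ≡ true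
  all-true⁻ {xs} h = to T-≡ ∘ All.lookup (all⁺ p xs (from T-≡ h))

  all-true⁺ : ∀ xs → (∀ {x} → x ∈ xs → p x ≡ true) → all p xs ≡ true
  all-true⁺ xs h = to T-≡ (all⁻ p (All.tabulate (from T-≡ ∘ h)))

  all-false⁻ : ∀ xs → all p xs ≡ false → ∃ λ x → x ∈ xs × p x ≡ false
  all-false⁻ (x ∷ xs) h with p x in px
  ... | false = x , here refl , px
  ... | true  = let y , y∈ , py = all-false⁻ xs h in y , there y∈ , py

  any-true⁻ : ∀ xs → any p xs ≡ true → ∃ λ x → x ∈ xs × p x ≡ true
  any-true⁻ xs h = let x , x∈ , px = find (any⁻ p xs (from T-≡ h)) in x , x∈ , to T-≡ px

  any-true⁺ : ∀ {xs x} → x ∈ xs → p x ≡ true → any p xs ≡ true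
  any-true⁺ x∈ px = to T-≡ (any⁺ p (lose x∈ (from T-≡ px)))

module _ {n : ℕ} where

  ==⇒≡ : {x y : Fin n} → (x == y) ≡ true → x ≡ y
  ==⇒≡ h = toWitness (from T-≡ h)

  ==-refl : (x : Fin n) → (x == x) ≡ true
  ==-refl x = trans (isYes≗does (x ≟ x)) (dec-true (x ≟ x) refl)

  ≢⇒==-false : {x y : Fin n} → x ≢ y → (x == y) ≡ false
  ≢⇒==-false {x} {y} x≢y = trans (isYes≗does (x ≟ y)) (dec-false (x ≟ y) x≢y)

module _ {n : ℕ} where

  infix 4 _∈V_ _⊆ᴱ_

  -- A record rather than a Σ-type, so that M can be inferred from a proof of x ∈V M.
  record _∈V_ (x : Fin n) (M : EdgeSet n) : Set where
    constructor covered
    field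
      {partner}   : Fin n
      partner-mem : mem M x partner ≡ true

  _⊆ᴱ_ : EdgeSet n → EdgeSet n → Set
  M ⊆ᴱ M′ = ∀ {x y} → mem M x y ≡ true → mem M′ x y ≡ true

  ∈V-mono : ∀ {M M′ x} → M ⊆ᴱ M′ → x ∈V M → x ∈V M′
  ∈V-mono M⊆M′ (covered m) = covered (M⊆M′ m)

  edgeSet : (Fin n → Fin n → Bool) → EdgeSet n
  edgeSet f = tabulate λ x → tabulate (f x)

  mem-edgeSet : ∀ f x y → mem (edgeSet f) x y ≡ f x y
  mem-edgeSet f x y rewrite lookup∘tabulate (λ x → tabulate (f x)) x = lookup∘tabulate (f x) y

  mem-ext : ∀ {M M′} → (∀ x y → mem M x y ≡ mem M′ x y) → M ≡ M′
  mem-ext h = Pointwise-≡⇒≡ (ext λ x → Pointwise-≡⇒≡ {n = n} (ext (h x)))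

  ⊆ᴱ-antisym : ∀ {M M′} → M ⊆ᴱ M′ → M′ ⊆ᴱ M → M ≡ M′
  ⊆ᴱ-antisym M⊆M′ M′⊆M = mem-ext λ x y → true⇔true⇒≡ M⊆M′ M′⊆M

  infixl 6 _∪ᴱ_

  _∪ᴱ_ : EdgeSet n → EdgeSet n → EdgeSet n
  M₁ ∪ᴱ M₂ = edgeSet λ x y → mem M₁ x y ∨ mem M₂ x y

  edge : Fin n → Fin n → EdgeSet n
  edge a b = edgeSet λ x y → (x == a ∧ y == b) ∨ (x == b ∧ y == a)

  relabel : (Fin n → Fin n) → EdgeSet n → EdgeSet n
  relabel σ M = edgeSet λ x y → mem M (σ x) (σ y)

  module _ (M₁ M₂ : EdgeSet n) where

    mem-∪ : ∀ x y → mem (M₁ ∪ᴱ M₂) x y ≡ mem M₁ x y ∨ mem M₂ x y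
    mem-∪ = mem-edgeSet _

    ⊆ᴱ-∪ˡ : M₁ ⊆ᴱ M₁ ∪ᴱ M₂
    ⊆ᴱ-∪ˡ {x} {y} m rewrite mem-∪ x y | m = refl

    ⊆ᴱ-∪ʳ : M₂ ⊆ᴱ M₁ ∪ᴱ M₂
    ⊆ᴱ-∪ʳ {x} {y} m rewrite mem-∪ x y | m = ∨-zeroʳ (mem M₁ x y)

    ∪-mem⁻ : ∀ {x y} → mem (M₁ ∪ᴱ M₂) x y ≡ true → mem M₁ x y ≡ true ⊎ mem M₂ x y ≡ true
    ∪-mem⁻ {x} {y} m = ∨-true⁻ (trans (sym (mem-∪ x y)) m)

    ∪-⊆ᴱ : ∀ {M} → M₁ ⊆ᴱ M → M₂ ⊆ᴱ M → M₁ ∪ᴱ M₂ ⊆ᴱ M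
    ∪-⊆ᴱ M₁⊆M M₂⊆M m = [ M₁⊆M , M₂⊆M ] (∪-mem⁻ m)

    ∪-∈V : ∀ {x} → x ∈V M₁ ∪ᴱ M₂ → x ∈V M₁ ⊎ x ∈V M₂
    ∪-∈V (covered m) = Sum.map covered covered (∪-mem⁻ m)

    ∪-mem-sym : (∀ x y → mem M₁ x y ≡ mem M₁ y x) → (∀ x y → mem M₂ x y ≡ mem M₂ y x) →
                ∀ x y → mem (M₁ ∪ᴱ M₂) x y ≡ mem (M₁ ∪ᴱ M₂) y x
    ∪-mem-sym sym₁ sym₂ x y rewrite mem-∪ x y | mem-∪ y x = cong₂ _∨_ (sym₁ x y) (sym₂ x y)

  module _ (a b : Fin n) where

    mem-edge : ∀ x y → mem (edge a b) x y ≡ (x == a ∧ y == b) ∨ (x == b ∧ y == a)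
    mem-edge = mem-edgeSet _

    mem-edge⁻ : ∀ {x y} → mem (edge a b) x y ≡ true → (x ≡ a × y ≡ b) ⊎ (x ≡ b × y ≡ a)
    mem-edge⁻ {x} {y} m with ∨-true⁻ (trans (sym (mem-edge x y)) m)
    ... | inj₁ x=a∧y=b = let x=a , y=b = ∧-true⁻ x=a∧y=b in inj₁ (==⇒≡ x=a , ==⇒≡ y=b)
    ... | inj₂ x=b∧y=a = let x=b , y=a = ∧-true⁻ x=b∧y=a in inj₂ (==⇒≡ x=b , ==⇒≡ y=a)

    mem-edge-ab : mem (edge a b) a b ≡ true
    mem-edge-ab rewrite mem-edge a b | ==-refl a | ==-refl b = refl

    ∈V-edge⁻ : ∀ {x} → x ∈V edge a b → x ≡ a ⊎ x ≡ b
    ∈V-edge⁻ (covered m) with mem-edge⁻ m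
    ... | inj₁ (x≡a , _) = inj₁ x≡a
    ... | inj₂ (x≡b , _) = inj₂ x≡b

  mem-relabel : ∀ σ M x y → mem (relabel σ M) x y ≡ mem M (σ x) (σ y)
  mem-relabel σ M = mem-edgeSet _

-- Induced matchings

record IsInducedMatching {n : ℕ} (C : Adj n) (M : EdgeSet n) : Set where
  field
    mem-sym    : ∀ x y → mem M x y ≡ mem M y x
    mem⇒adj    : ∀ {x y} → mem M x y ≡ true → C x y ≡ true
    adj-unique : ∀ {x y z} → x ∈V M → y ∈V M → z ∈V M → C x y ≡ true → C x z ≡ true → y ≡ z

  partner∈V : ∀ {x y} → mem M x y ≡ true → y ∈V M
  partner∈V {x} {y} m = covered (trans (mem-sym y x) m)

IsMaximalInducedMatching : {n : ℕ} → Adj n → EdgeSet n → Set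
IsMaximalInducedMatching C M =
  IsInducedMatching C M × (∀ {M′} → IsInducedMatching C M′ → M ⊆ᴱ M′ → M′ ⊆ᴱ M)

module _ {n : ℕ} {C : Adj n} where

  IM-transfer : ∀ {D M} → IsInducedMatching C M → (∀ {x y} → x ∈V M → y ∈V M → C x y ≡ D x y) →
                IsInducedMatching D M
  IM-transfer im C≡D = record
    { mem-sym    = mem-sym
    ; mem⇒adj    = λ m → trans (sym (C≡D (covered m) (partner∈V m))) (mem⇒adj m)
    ; adj-unique = λ x∈ y∈ z∈ dxy dxz → adj-unique x∈ y∈ z∈ (trans (C≡D x∈ y∈) dxy) (trans (C≡D x∈ z∈) dxz)
    }
    where open IsInducedMatching im

  IM-⊆ : ∀ {M M′} → IsInducedMatching C M′ → M ⊆ᴱ M′ → (∀ x y → mem M x y ≡ mem M y x) → IsInducedMatching C M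
  IM-⊆ im′ M⊆M′ sym-M = record
    { mem-sym    = sym-M
    ; mem⇒adj    = mem⇒adj ∘ M⊆M′
    ; adj-unique = λ x∈ y∈ z∈ → adj-unique (∈V-mono M⊆M′ x∈) (∈V-mono M⊆M′ y∈) (∈V-mono M⊆M′ z∈)
    }
    where open IsInducedMatching im′

  module _ (simple : IsSimple C) where

    open IsSimple simple renaming (sym to C-sym; irrfl to C-irrefl)

    edge-IM : ∀ {a b} → C a b ≡ true → IsInducedMatching C (edge a b)
    edge-IM {a} {b} cab = record
      { mem-sym    = λ x y → trans (mem-edge a b x y) (trans (cong₂ _∨_ (∧-comm (x == a) (y == b)) (∧-comm (x == b) (y == a)))
                                   (trans (∨-comm (y == b ∧ x == a) (y == a ∧ x == b)) (sym (mem-edge a b y x))))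
      ; mem⇒adj    = adj
      ; adj-unique = unique
      }
      where
        adj : ∀ {x y} → mem (edge a b) x y ≡ true → C x y ≡ true
        adj m with mem-edge⁻ a b m
        ... | inj₁ (refl , refl) = cab
        ... | inj₂ (refl , refl) = trans (C-sym _ _) cab

        ≢-self : ∀ {x y} → C x y ≡ true → x ≢ y
        ≢-self cxy refl = true≢false cxy (C-irrefl _)

        unique : ∀ {x y z} → x ∈V edge a b → y ∈V edge a b → z ∈V edge a b → C x y ≡ true → C x z ≡ true → y ≡ z
        unique x∈ y∈ z∈ cxy cxz with ∈V-edge⁻ a b x∈ | ∈V-edge⁻ a b y∈ | ∈V-edge⁻ a b z∈
        ... | _        | inj₁ refl | inj₁ refl = refl
        ... | _        | inj₂ refl | inj₂ refl = refl
        ... | inj₁ refl | inj₁ refl | inj₂ refl = contradiction refl (≢-self cxy)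
        ... | inj₂ refl | inj₁ refl | inj₂ refl = contradiction refl (≢-self cxz)
        ... | inj₁ refl | inj₂ refl | inj₁ refl = contradiction refl (≢-self cxz)
        ... | inj₂ refl | inj₂ refl | inj₁ refl = contradiction refl (≢-self cxy)

    ∪-IM : ∀ {M₁ M₂} → IsInducedMatching C M₁ → IsInducedMatching C M₂ →
           (∀ {x y} → x ∈V M₁ → y ∈V M₂ → C x y ≡ false) → IsInducedMatching C (M₁ ∪ᴱ M₂)
    ∪-IM {M₁} {M₂} im₁ im₂ apart = record
      { mem-sym    = ∪-mem-sym M₁ M₂ (mem-sym im₁) (mem-sym im₂)
      ; mem⇒adj    = [ mem⇒adj im₁ , mem⇒adj im₂ ] ∘ ∪-mem⁻ M₁ M₂
      ; adj-unique = unique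
      }
      where
        open IsInducedMatching

        stays-in₁ : ∀ {x y} → x ∈V M₁ → y ∈V M₁ ∪ᴱ M₂ → C x y ≡ true → y ∈V M₁
        stays-in₁ x∈₁ y∈ cxy with ∪-∈V M₁ M₂ y∈
        ... | inj₁ y∈₁ = y∈₁
        ... | inj₂ y∈₂ = contradiction (apart x∈₁ y∈₂) (true≢false cxy)

        stays-in₂ : ∀ {x y} → x ∈V M₂ → y ∈V M₁ ∪ᴱ M₂ → C x y ≡ true → y ∈V M₂
        stays-in₂ x∈₂ y∈ cxy with ∪-∈V M₁ M₂ y∈
        ... | inj₁ y∈₁ = contradiction (apart y∈₁ x∈₂) (true≢false (trans (C-sym _ _) cxy))
        ... | inj₂ y∈₂ = y∈₂

        unique : ∀ {x y z} → x ∈V M₁ ∪ᴱ M₂ → y ∈V M₁ ∪ᴱ M₂ → z ∈V M₁ ∪ᴱ M₂ → C x y ≡ true → C x z ≡ true → y ≡ z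
        unique x∈ y∈ z∈ cxy cxz with ∪-∈V M₁ M₂ x∈
        ... | inj₁ x∈₁ = adj-unique im₁ x∈₁ (stays-in₁ x∈₁ y∈ cxy) (stays-in₁ x∈₁ z∈ cxz) cxy cxz
        ... | inj₂ x∈₂ = adj-unique im₂ x∈₂ (stays-in₂ x∈₂ y∈ cxy) (stays-in₂ x∈₂ z∈ cxz) cxy cxz

    maximal⇒dominating : ∀ {M a b} → IsMaximalInducedMatching C M → C a b ≡ true →
                         (∀ {z} → z ∈V M → C a z ≡ false) → (∀ {z} → z ∈V M → C b z ≡ false) → ⊥
    maximal⇒dominating {M} {a} {b} (im , maximal) cab a-free b-free =
      true≢false cab (a-free (partner∈V mab))
      where
        open IsInducedMatching im using (partner∈V)

        apart : ∀ {x y} → x ∈V M → y ∈V edge a b → C x y ≡ false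
        apart {x} x∈ y∈ with ∈V-edge⁻ a b y∈
        ... | inj₁ refl = trans (C-sym x a) (a-free x∈)
        ... | inj₂ refl = trans (C-sym x b) (b-free x∈)

        mab : mem M a b ≡ true
        mab = maximal (∪-IM im (edge-IM cab) apart) (⊆ᴱ-∪ˡ M (edge a b)) (⊆ᴱ-∪ʳ M (edge a b) (mem-edge-ab a b))

  maximal-∪-IM⇒≡ : ∀ {M₁ M₂} → IsMaximalInducedMatching C M₁ → IsMaximalInducedMatching C M₂ →
                   IsInducedMatching C (M₁ ∪ᴱ M₂) → M₁ ≡ M₂
  maximal-∪-IM⇒≡ {M₁} {M₂} (_ , maximal₁) (_ , maximal₂) im∪ =
    ⊆ᴱ-antisym (maximal₂ im∪ (⊆ᴱ-∪ʳ M₁ M₂) ∘ ⊆ᴱ-∪ˡ M₁ M₂) (maximal₁ im∪ (⊆ᴱ-∪ˡ M₁ M₂) ∘ ⊆ᴱ-∪ʳ M₁ M₂)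

module _ {n : ℕ} {σ : Fin n → Fin n} (σ-involutive : ∀ x → σ (σ x) ≡ x) where

  private
    σ-injective : ∀ {x y} → σ x ≡ σ y → x ≡ y
    σ-injective {x} {y} σx≡σy = trans (sym (σ-involutive x)) (trans (cong σ σx≡σy) (σ-involutive y))

    mem-relabel² : ∀ M x y → mem (relabel σ M) (σ x) (σ y) ≡ mem M x y
    mem-relabel² M x y = trans (mem-relabel σ M (σ x) (σ y)) (cong₂ (mem M) (σ-involutive x) (σ-involutive y))

  relabel-involutive : ∀ M → relabel σ (relabel σ M) ≡ M
  relabel-involutive M = mem-ext λ x y → trans (mem-relabel σ (relabel σ M) x y) (mem-relabel² M x y)

  relabel-⊆ᴱ-swap : ∀ {M M′} → relabel σ M ⊆ᴱ M′ → M ⊆ᴱ relabel σ M′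
  relabel-⊆ᴱ-swap {M} {M′} σM⊆M′ {x} {y} m =
    trans (mem-relabel σ M′ x y) (σM⊆M′ (trans (mem-relabel² M x y) m))

  ∈V-relabel⁻ : ∀ {M x} → x ∈V relabel σ M → σ x ∈V M
  ∈V-relabel⁻ {M} {x} (covered {y} m) = covered (trans (sym (mem-relabel σ M x y)) m)

  ∈V-relabel⁺ : ∀ {M x} → σ x ∈V M → x ∈V relabel σ M
  ∈V-relabel⁺ {M} {x} (covered {y} m) =
    covered (trans (mem-relabel σ M x (σ y)) (subst (λ w → mem M (σ x) w ≡ true) (sym (σ-involutive y)) m))

  module _ {C : Adj n} (σ-automorphism : ∀ x y → C (σ x) (σ y) ≡ C x y) where

    relabel-IM : ∀ {M} → IsInducedMatching C M → IsInducedMatching C (relabel σ M)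
    relabel-IM {M} im = record
      { mem-sym    = λ x y → trans (mem-relabel σ M x y) (trans (mem-sym (σ x) (σ y)) (sym (mem-relabel σ M y x)))
      ; mem⇒adj    = λ {x} {y} m → trans (sym (σ-automorphism x y)) (mem⇒adj (trans (sym (mem-relabel σ M x y)) m))
      ; adj-unique = λ x∈ y∈ z∈ cxy cxz →
          σ-injective (adj-unique (∈V-relabel⁻ x∈) (∈V-relabel⁻ y∈) (∈V-relabel⁻ z∈)
                                  (trans (σ-automorphism _ _) cxy) (trans (σ-automorphism _ _) cxz))
      }
      where open IsInducedMatching im

    relabel-MIM : ∀ {M} → IsMaximalInducedMatching C M → IsMaximalInducedMatching C (relabel σ M)
    relabel-MIM {M} (im , maximal) =
      relabel-IM im , λ {M′} im′ σM⊆M′ →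
        relabel-⊆ᴱ-swap {M′} {M} (maximal (relabel-IM im′) (relabel-⊆ᴱ-swap {M} {M′} σM⊆M′))

allVecs-suc : ∀ {A : Set} k (xs : List A) → allVecs (suc k) xs ≡ cartesianProductWith _∷_ xs (allVecs k xs)
allVecs-suc k xs = concatMap-map≡cartesianProductWith xs
  where
    concatMap-map≡cartesianProductWith : ∀ ys → concatMap (λ a → map (a ∷_) (allVecs k xs)) ys
                                              ≡ cartesianProductWith _∷_ ys (allVecs k xs)
    concatMap-map≡cartesianProductWith []       = refl
    concatMap-map≡cartesianProductWith (y ∷ ys) = cong (map (y ∷_) (allVecs k xs) ++_) (concatMap-map≡cartesianProductWith ys)

allVecs-complete : ∀ {A : Set} k {xs : List A} → (∀ x → x ∈ xs) → ∀ v → v ∈ allVecs k xs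
allVecs-complete zero    _        []      = here refl
allVecs-complete (suc k) {xs} complete (a ∷ v) rewrite allVecs-suc k xs =
  ∈-cartesianProductWith⁺ _∷_ (complete a) (allVecs-complete k complete v)

allVecs-unique : ∀ {A : Set} k {xs : List A} → Unique xs → Unique (allVecs k xs)
allVecs-unique zero    _ = [] ∷ []
allVecs-unique (suc k) {xs} !xs rewrite allVecs-suc k xs =
  cartesianProductWith⁺ _∷_ Vec.∷-injective !xs (allVecs-unique k !xs)

allEdgeSets-complete : ∀ {n} (M : EdgeSet n) → M ∈ allEdgeSets n
allEdgeSets-complete {n} = allVecs-complete n (allVecs-complete n λ { true → here refl ; false → there (here refl) })

allEdgeSets-unique : ∀ n → Unique (allEdgeSets n)
allEdgeSets-unique n = allVecs-unique n (allVecs-unique n (((λ ()) ∷ []) ∷ [] ∷ []))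

count : ∀ {X : Set} → (X → Bool) → List X → ℕ
count p xs = length (filter (λ x → T? (p x)) xs)

count-split : ∀ {X : Set} (p q : X → Bool) xs →
              count p xs ≡ count (λ x → p x ∧ q x) xs + count (λ x → p x ∧ not (q x)) xs
count-split p q []       = refl
count-split p q (x ∷ xs) with p x | q x
... | false | _     = count-split p q xs
... | true  | true  = cong suc (count-split p q xs)
... | true  | false = trans (cong suc (count-split p q xs)) (sym (ℕ.+-suc _ _))

length-≤-injection : ∀ {X Y : Set} {xs : List X} {ys : List Y} → Unique xs → (f : ∀ {x} → x ∈ xs → Y) →
                     (∀ {x} (x∈ : x ∈ xs) → f x∈ ∈ ys) →
                     (∀ {x y} (x∈ : x ∈ xs) (y∈ : y ∈ xs) → f x∈ ≡ f y∈ → x ≡ y) →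
                     length xs ≤ length ys
length-≤-injection {xs = []} _ _ _ _ = z≤n
length-≤-injection {xs = x ∷ xs} {ys} (x∉xs ∷ !xs) f f∈ f-injective
  with ys₁ , ys₂ , refl ← ∈-∃++ (f∈ (here refl)) = begin
    suc (length xs)           ≤⟨ s≤s (length-≤-injection !xs (f ∘ there) f∈ys₁++ys₂ (λ a b → f-injective (there a) (there b))) ⟩
    suc (length (ys₁ ++ ys₂)) ≡⟨ cong suc (length-++ ys₁) ⟩
    suc (length ys₁ + length ys₂) ≡⟨ ℕ.+-suc (length ys₁) (length ys₂) ⟨
    length ys₁ + suc (length ys₂) ≡⟨ length-++ ys₁ ⟨
    length (ys₁ ++ f (here refl) ∷ ys₂) ∎
  where
    open ℕ.≤-Reasoning

    f∈ys₁++ys₂ : ∀ {z} (z∈ : z ∈ xs) → f (there z∈) ∈ ys₁ ++ ys₂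
    f∈ys₁++ys₂ z∈ with ∈-++⁻ ys₁ (f∈ (there z∈))
    ... | inj₁ ∈ys₁          = ∈-++⁺ˡ ∈ys₁
    ... | inj₂ (here fz≡fx)  = contradiction (f-injective (here refl) (there z∈) (sym fz≡fx)) (All.lookup x∉xs z∈)
    ... | inj₂ (there ∈ys₂) = ∈-++⁺ʳ ys₁ ∈ys₂

count-≤-injection : ∀ {X : Set} {xs : List X} (p q : X → Bool) → Unique xs → (f : ∀ x → p x ≡ true → X) →
                    (∀ x px → f x px ∈ xs) → (∀ x px → q (f x px) ≡ true) →
                    (∀ x y px py → f x px ≡ f y py → x ≡ y) →
                    count p xs ≤ count q xs
count-≤-injection {xs = xs} p q !xs f f∈ qf f-injective =
  length-≤-injection (filter⁺ (λ x → T? (p x)) !xs) (λ {x} x∈ → f x (p-holds x∈))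
    (λ {x} x∈ → ∈-filter⁺ (λ x → T? (q x)) (f∈ x _) (from T-≡ (qf x _)))
    (λ {x} {y} x∈ y∈ → f-injective x y _ _)
  where
    p-holds : ∀ {x} → x ∈ filter (λ x → T? (p x)) xs → p x ≡ true
    p-holds = to T-≡ ∘ proj₂ ∘ ∈-filter⁻ (λ x → T? (p x)) {xs = xs}

module _ {n : ℕ} (C : Adj n) where

  exactlyOne-unique : ∀ {X : Set} (f : X → Bool) xs → exactlyOne C (map f xs) ≡ true →
                      ∀ {y z} → y ∈ xs → z ∈ xs → f y ≡ true → f z ≡ true → y ≡ z
  exactlyOne-unique f (x ∷ xs) h y∈ z∈ fy fz with f x in fx
  ... | true  = trans (at-head y∈ fy) (sym (at-head z∈ fz))
    where
      at-head : ∀ {w} → w ∈ x ∷ xs → f w ≡ true → w ≡ x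
      at-head (here w≡x) _  = w≡x
      at-head (there w∈) fw = contradiction (subst (λ b → not b ≡ true) fw (all-true⁻ not h (∈-map⁺ f w∈))) λ ()
  ... | false = exactlyOne-unique f xs h (off-head y∈ fy) (off-head z∈ fz) fy fz
    where
      off-head : ∀ {w} → w ∈ x ∷ xs → f w ≡ true → w ∈ xs
      off-head (here refl) fw = contradiction (trans (sym fw) fx) λ ()
      off-head (there w∈)  _  = w∈

  exactlyOne-intro : ∀ {X : Set} (f : X → Bool) {xs} → Unique xs → ∀ {y} → y ∈ xs → f y ≡ true →
                     (∀ {z} → z ∈ xs → f z ≡ true → z ≡ y) → exactlyOne C (map f xs) ≡ true
  exactlyOne-intro f {x ∷ xs} (x∉xs ∷ !xs) (here refl) fy only-y rewrite fy =
    all-true⁺ not (map f xs) λ b∈ → let z , z∈ , b≡fz = ∈-map⁻ f b∈ in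
      subst (λ b → not b ≡ true) (sym b≡fz) (cong not (¬-not λ fz → All.lookup x∉xs z∈ (sym (only-y (there z∈) fz))))
  exactlyOne-intro f {x ∷ xs} (x∉xs ∷ !xs) (there y∈) fy only-y with f x in fx
  ... | true  = contradiction (only-y (here refl) fx) (All.lookup x∉xs y∈)
  ... | false = exactlyOne-intro f !xs y∈ fy (only-y ∘ there)

  inV-true⁻ : ∀ M x → inV C M x ≡ true → x ∈V M
  inV-true⁻ M x h = let _ , _ , m = any-true⁻ (mem M x) (allFin n) h in covered m

  inV-true⁺ : ∀ M x → x ∈V M → inV C M x ≡ true
  inV-true⁺ M x (covered {y} m) = any-true⁺ (mem M x) (∈-allFin y) m

  not-inV-true⁻ : ∀ M x → not (inV C M x) ≡ true → ¬ x ∈V M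
  not-inV-true⁻ M x h x∈ = true≢false (inV-true⁺ M x x∈) (not-true⁻ h)

  not-inV-true⁺ : ∀ M x → ¬ x ∈V M → not (inV C M x) ≡ true
  not-inV-true⁺ M x x∉ = cong not (¬-not (x∉ ∘ inV-true⁻ M x))

  isEdgeSubset-true⁻ : ∀ M → isEdgeSubset C M ≡ true →
                       ∀ x y → mem M x y ≡ mem M y x × (mem M x y ≡ true → C x y ≡ true)
  -- In the two asymmetric cases pair-ok is absurd.
  isEdgeSubset-true⁻ M h x y with all-true⁻ _ (all-true⁻ _ h (∈-allFin x)) (∈-allFin y)
  ... | pair-ok with mem M x y | mem M y x
  ... | true  | true  = refl , λ _ → pair-ok
  ... | false | false = refl , λ ()

  isEdgeSubset-true⁺ : ∀ M → (∀ x y → mem M x y ≡ mem M y x) → (∀ {x y} → mem M x y ≡ true → C x y ≡ true) →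
                       isEdgeSubset C M ≡ true
  isEdgeSubset-true⁺ M sym-M M⇒C with isEdgeSubset C M in e
  ... | true  = refl
  ... | false with x , _ , row-fails ← all-false⁻ _ (allFin n) e
              with y , _ , pair-fails ← all-false⁻ _ (allFin n) row-fails
              with mem M x y in mxy | mem M y x in myx
  ... | true  | true  = contradiction (trans (sym (M⇒C mxy)) pair-fails) λ ()
  ... | false | false = contradiction pair-fails λ ()
  ... | true  | false = contradiction (trans (sym mxy) (trans (sym-M x y) myx)) λ ()
  ... | false | true  = contradiction (trans (sym myx) (trans (sym-M y x) mxy)) λ ()

  isInducedMatching-true⁻ : ∀ M → isInducedMatching C M ≡ true → IsInducedMatching C M
  isInducedMatching-true⁻ M h = record
    { mem-sym    = λ x y → proj₁ (edge-ok x y)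
    ; mem⇒adj    = λ {x} {y} → proj₂ (edge-ok x y)
    ; adj-unique = unique
    }
    where
      edge-ok = isEdgeSubset-true⁻ M (proj₁ (∧-true⁻ h))

      unique : ∀ {x y z} → x ∈V M → y ∈V M → z ∈V M → C x y ≡ true → C x z ≡ true → y ≡ z
      unique {x} x∈ y∈ z∈ cxy cxz =
        exactlyOne-unique (λ y → inV C M y ∧ C x y) (allFin n)
          (not∨-true⁻ (inV-true⁺ M x x∈) (all-true⁻ _ (proj₂ (∧-true⁻ h)) (∈-allFin x)))
          (∈-allFin _) (∈-allFin _) (cong₂ _∧_ (inV-true⁺ M _ y∈) cxy) (cong₂ _∧_ (inV-true⁺ M _ z∈) cxz)

  isInducedMatching-true⁺ : ∀ M → IsInducedMatching C M → isInducedMatching C M ≡ true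
  isInducedMatching-true⁺ M im = cong₂ _∧_ (isEdgeSubset-true⁺ M mem-sym mem⇒adj) (all-true⁺ _ (allFin n) λ {x} _ → degree-one x)
    where
      open IsInducedMatching im

      degree-one : ∀ x → not (inV C M x) ∨ exactlyOne C (map (λ y → inV C M y ∧ C x y) (allFin n)) ≡ true
      degree-one x with inV C M x in x∈
      ... | false = refl
      ... | true  with covered {y} mxy ← inV-true⁻ M x x∈ =
        exactlyOne-intro _ (allFin⁺ n) (∈-allFin y) (cong₂ _∧_ (inV-true⁺ M y (partner∈V mxy)) (mem⇒adj mxy))
          λ {z} _ fz → let z∈ , cxz = ∧-true⁻ fz in
            adj-unique (inV-true⁻ M x x∈) (inV-true⁻ M z z∈) (partner∈V mxy) cxz (mem⇒adj mxy)

  subsetEq-true⁻ : ∀ M M′ → subsetEq C M M′ ≡ true → M ⊆ᴱ M′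
  subsetEq-true⁻ M M′ h {x} {y} mxy = not∨-true⁻ mxy (all-true⁻ _ (all-true⁻ _ h (∈-allFin x)) (∈-allFin y))

  subsetEq-true⁺ : ∀ M M′ → M ⊆ᴱ M′ → subsetEq C M M′ ≡ true
  subsetEq-true⁺ M M′ M⊆M′ = all-true⁺ _ (allFin n) λ {x} _ → all-true⁺ _ (allFin n) λ {y} _ → pair-ok x y
    where
      pair-ok : ∀ x y → not (mem M x y) ∨ mem M′ x y ≡ true
      pair-ok x y with mem M x y in mxy
      ... | false = refl
      ... | true  = M⊆M′ mxy

  subsetEq-false⁻ : ∀ M M′ → subsetEq C M M′ ≡ false → ∃₂ λ x y → mem M x y ≡ true × mem M′ x y ≡ false
  subsetEq-false⁻ M M′ h with x , _ , row-fails ← all-false⁻ _ (allFin n) h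
                         with y , _ , pair-fails ← all-false⁻ _ (allFin n) row-fails
                         with mem M x y in mxy
  ... | true = x , y , mxy , pair-fails

  isMaximalInducedMatching-true⁻ : ∀ M → isMaximalInducedMatching C M ≡ true → IsMaximalInducedMatching C M
  isMaximalInducedMatching-true⁻ M h = isInducedMatching-true⁻ M (proj₁ (∧-true⁻ h)) , maximal
    where
      maximal : ∀ {M′} → IsInducedMatching C M′ → M ⊆ᴱ M′ → M′ ⊆ᴱ M
      maximal {M′} im′ M⊆M′ =
        subsetEq-true⁻ M′ M (excluded (isInducedMatching-true⁺ M′ im′) (subsetEq-true⁺ M M′ M⊆M′)
          (all-true⁻ (λ M″ → not (isInducedMatching C M″ ∧ properSubset C M M″)) (proj₂ (∧-true⁻ h))
            (allEdgeSets-complete M′)))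
        where
          excluded : ∀ {a b c} → a ≡ true → b ≡ true → not (a ∧ (b ∧ not c)) ≡ true → c ≡ true
          excluded refl refl = trans (sym (not-involutive _))

  isMaximalInducedMatching-true⁺ : ∀ M → IsMaximalInducedMatching C M → isMaximalInducedMatching C M ≡ true
  isMaximalInducedMatching-true⁺ M (im , maximal) =
    cong₂ _∧_ (isInducedMatching-true⁺ M im) (all-true⁺ _ (allEdgeSets n) λ {M′} _ → not-above M′)
    where
      not-above : ∀ M′ → not (isInducedMatching C M′ ∧ properSubset C M M′) ≡ true
      not-above M′ with isInducedMatching C M′ in im′ | subsetEq C M M′ in M⊆M′
      ... | false | _     = refl
      ... | true  | false = refl
      ... | true  | true  rewrite subsetEq-true⁺ M′ M (maximal (isInducedMatching-true⁻ M′ im′) (subsetEq-true⁻ M M′ M⊆M′)) = refl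

-- Every induced matching extends to a maximal one

module _ {n : ℕ} where

  infix 4 _⊂ᴱ_ _⊃ᴱ_

  _⊂ᴱ_ _⊃ᴱ_ : EdgeSet n → EdgeSet n → Set
  M ⊂ᴱ M′ = M ⊆ᴱ M′ × ∃₂ λ x y → mem M′ x y ≡ true × mem M x y ≡ false
  M′ ⊃ᴱ M = M ⊂ᴱ M′

  concat-⊂ : ∀ {M M′} → M ⊂ᴱ M′ → concat M ⊂ concat M′
  concat-⊂ {M} {M′} (M⊆M′ , x , y , m′xy , mxy) =
    concat-⊆ , combine x y , lookup⇒[]= _ _ (trans (lookup-concat M′ x y) m′xy) ,
    λ xy∈M → true≢false (trans (sym (lookup-concat M x y)) ([]=⇒lookup xy∈M)) mxy
    where
      concat-⊆ : concat M ⊆ concat M′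
      concat-⊆ {i} i∈M with a , b , refl ← combine-surjective {n} {n} i =
        lookup⇒[]= _ _ (trans (lookup-concat M′ a b) (M⊆M′ (trans (sym (lookup-concat M a b)) ([]=⇒lookup i∈M))))

  ⊃ᴱ-wellFounded : WellFounded _⊃ᴱ_
  ⊃ᴱ-wellFounded = Subrelation.wellFounded {_<₂_ = _⊃_ on concat} (λ {M′} {M} → concat-⊂ {M} {M′}) (On.wellFounded concat ⊃-wellFounded)

module _ {n : ℕ} (C : Adj n) where

  maximal-or-extendable : ∀ M → IsInducedMatching C M →
                          IsMaximalInducedMatching C M ⊎ ∃ λ M′ → IsInducedMatching C M′ × M ⊂ᴱ M′
  -- In every case but the one listed, above is absurd.
  maximal-or-extendable M im with all (λ M′ → not (isInducedMatching C M′ ∧ properSubset C M M′)) (allEdgeSets n) in none-above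
  ... | true  = inj₁ (isMaximalInducedMatching-true⁻ C M (cong₂ _∧_ (isInducedMatching-true⁺ C M im) none-above))
  ... | false
    with M′ , _ , above ← all-false⁻ _ (allEdgeSets n) none-above
    with isInducedMatching C M′ in im′ | subsetEq C M M′ in M⊆M′ | subsetEq C M′ M in M′⊆M
  ... | true | true | false =
    inj₂ (M′ , isInducedMatching-true⁻ C M′ im′ , subsetEq-true⁻ C M M′ M⊆M′ , subsetEq-false⁻ C M′ M M′⊆M)

  maximal-extension : ∀ M → IsInducedMatching C M → ∃ λ M* → IsMaximalInducedMatching C M* × M ⊆ᴱ M*
  maximal-extension M = extend (⊃ᴱ-wellFounded M)
    where
      extend : ∀ {M} → Acc _⊃ᴱ_ M → IsInducedMatching C M → ∃ λ M* → IsMaximalInducedMatching C M* × M ⊆ᴱ M*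
      extend {M} (acc larger) im with maximal-or-extendable M im
      ... | inj₁ maximal = M , maximal , id
      ... | inj₂ (M′ , im′ , M⊂M′) =
        let M* , maximal* , M′⊆M* = extend (larger M⊂M′) im′ in M* , maximal* , M′⊆M* ∘ proj₁ M⊂M′

-- Twins and transpositions

module _ {n : ℕ} (u v : Fin n) where

  private
    τ : Fin n → Fin n
    τ = transpose u v

  data Role (x : Fin n) : Set where
    is-u  : x ≡ u → Role x
    is-v  : x ≡ v → Role x
    other : x ≢ u → x ≢ v → Role x

  role : ∀ x → Role x
  role x with x ≟ u | x ≟ v
  ... | yes x≡u | _       = is-u x≡u
  ... | no _    | yes x≡v = is-v x≡v
  ... | no x≢u  | no x≢v  = other x≢u x≢v

  transpose-matchˡ : τ u ≡ v
  transpose-matchˡ rewrite dec-true (u ≟ u) refl = refl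

  transpose-matchʳ : τ v ≡ u
  transpose-matchʳ with v ≟ u
  ... | yes v≡u = v≡u
  ... | no _    rewrite dec-true (v ≟ v) refl = refl

  transpose-other : ∀ {x} → x ≢ u → x ≢ v → τ x ≡ x
  transpose-other {x} x≢u x≢v rewrite dec-false (x ≟ u) x≢u | dec-false (x ≟ v) x≢v = refl

  transpose-involutive : ∀ x → τ (τ x) ≡ x
  transpose-involutive x with role x
  ... | is-u refl     rewrite transpose-matchˡ = transpose-matchʳ
  ... | is-v refl     rewrite transpose-matchʳ = transpose-matchˡ
  ... | other x≢u x≢v rewrite transpose-other x≢u x≢v = transpose-other x≢u x≢v

  module _ {C : Adj n} (simple : IsSimple C) where

    open IsSimple simple renaming (sym to C-sym; irrfl to C-irrefl)

    twins⇒transpose-automorphism : (∀ z → z ≢ u → z ≢ v → C u z ≡ C v z) → ∀ x y → C (τ x) (τ y) ≡ C x y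
    twins⇒transpose-automorphism twins x y with role x | role y
    ... | is-u refl | is-u refl rewrite transpose-matchˡ = trans (C-irrefl v) (sym (C-irrefl u))
    ... | is-u refl | is-v refl rewrite transpose-matchˡ | transpose-matchʳ = C-sym v u
    ... | is-u refl | other y≢u y≢v rewrite transpose-matchˡ | transpose-other y≢u y≢v = sym (twins y y≢u y≢v)
    ... | is-v refl | is-u refl rewrite transpose-matchˡ | transpose-matchʳ = C-sym u v
    ... | is-v refl | is-v refl rewrite transpose-matchʳ = trans (C-irrefl u) (sym (C-irrefl v))
    ... | is-v refl | other y≢u y≢v rewrite transpose-matchʳ | transpose-other y≢u y≢v = twins y y≢u y≢v
    ... | other x≢u x≢v | is-u refl rewrite transpose-matchˡ | transpose-other x≢u x≢v =
      trans (C-sym x v) (trans (sym (twins x x≢u x≢v)) (C-sym u x))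
    ... | other x≢u x≢v | is-v refl rewrite transpose-matchʳ | transpose-other x≢u x≢v =
      trans (C-sym x u) (trans (twins x x≢u x≢v) (C-sym v x))
    ... | other x≢u x≢v | other y≢u y≢v rewrite transpose-other x≢u x≢v | transpose-other y≢u y≢v = refl

-- Maximal induced matchings classified by how they meet u and v

module _ {n : ℕ} (C : Adj n) (u : Fin n) where

  mimAvoiding : EdgeSet n → Bool
  mimAvoiding M = isMaximalInducedMatching C M ∧ not (inV C M u)

  module _ {M : EdgeSet n} where

    mimAvoiding⁻ : mimAvoiding M ≡ true → IsMaximalInducedMatching C M × ¬ u ∈V M
    mimAvoiding⁻ h = let maximal , u∉ = ∧-true⁻ h in
      isMaximalInducedMatching-true⁻ C M maximal , not-inV-true⁻ C M u u∉

    mimAvoiding⁺ : IsMaximalInducedMatching C M → ¬ u ∈V M → mimAvoiding M ≡ true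
    mimAvoiding⁺ mim u∉ = cong₂ _∧_ (isMaximalInducedMatching-true⁺ C M mim) (not-inV-true⁺ C M u u∉)

module _ {n : ℕ} (C : Adj n) (u v : Fin n) where

  mimCoveringBoth mimCoveringOnly : EdgeSet n → Bool
  mimCoveringBoth M = (isMaximalInducedMatching C M ∧ inV C M u) ∧ inV C M v
  mimCoveringOnly M = (isMaximalInducedMatching C M ∧ inV C M u) ∧ not (inV C M v)

  numMIM-split : numMIM C ≡ (count mimCoveringBoth (allEdgeSets n) + count mimCoveringOnly (allEdgeSets n))
                            + count (mimAvoiding C u) (allEdgeSets n)
  numMIM-split = trans (count-split (isMaximalInducedMatching C) (λ M → inV C M u) (allEdgeSets n))
                       (cong (_+ count (mimAvoiding C u) (allEdgeSets n))
                             (count-split (λ M → isMaximalInducedMatching C M ∧ inV C M u) (λ M → inV C M v) (allEdgeSets n)))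

  module _ {M : EdgeSet n} where

    mimCoveringBoth⁻ : mimCoveringBoth M ≡ true → IsMaximalInducedMatching C M × u ∈V M × v ∈V M
    mimCoveringBoth⁻ h = let maximal∧u , v∈ = ∧-true⁻ h ; maximal , u∈ = ∧-true⁻ maximal∧u in
      isMaximalInducedMatching-true⁻ C M maximal , inV-true⁻ C M u u∈ , inV-true⁻ C M v v∈

    mimCoveringBoth⁺ : IsMaximalInducedMatching C M → u ∈V M → v ∈V M → mimCoveringBoth M ≡ true
    mimCoveringBoth⁺ mim u∈ v∈ =
      cong₂ _∧_ (cong₂ _∧_ (isMaximalInducedMatching-true⁺ C M mim) (inV-true⁺ C M u u∈)) (inV-true⁺ C M v v∈)

    mimCoveringOnly⁻ : mimCoveringOnly M ≡ true → IsMaximalInducedMatching C M × u ∈V M × ¬ v ∈V M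
    mimCoveringOnly⁻ h = let maximal∧u , v∉ = ∧-true⁻ h ; maximal , u∈ = ∧-true⁻ maximal∧u in
      isMaximalInducedMatching-true⁻ C M maximal , inV-true⁻ C M u u∈ , not-inV-true⁻ C M v v∉

    mimCoveringOnly⁺ : IsMaximalInducedMatching C M → u ∈V M → ¬ v ∈V M → mimCoveringOnly M ≡ true
    mimCoveringOnly⁺ mim u∈ v∉ =
      cong₂ _∧_ (cong₂ _∧_ (isMaximalInducedMatching-true⁺ C M mim) (inV-true⁺ C M u u∈)) (not-inV-true⁺ C M v v∉)

-- The graph G_{u→v}

module _ {n : ℕ} (A : Adj n) (u v : Fin n) where

  W₁ W₄ : Fin n → Bool
  W₁ x = A u x ∧ not (inClosedN A v x)
  W₄ x = not (inClosedN A u x ∨ inClosedN A v x)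

  NoMIMInsideW₁∪W₄MeetingW₁ : Set
  NoMIMInsideW₁∪W₄MeetingW₁ =
    ∀ (M : EdgeSet n) → isMaximalInducedMatching A M ≡ true →
    (∀ x → inV A M x ≡ true → W₁ x ∨ W₄ x ≡ true) → ∃ (λ x → inV A M x ≡ true × W₁ x ≡ true) → ⊥

module Shift {n : ℕ} (A : Adj n) (simple : IsSimple A) (u v : Fin n) (uv : A u v ≡ true) where

  open IsSimple simple renaming (sym to A-sym; irrfl to A-irrefl)

  B : Adj n
  B = shift A u v

  u≢v : u ≢ v
  u≢v refl = true≢false uv (A-irrefl u)

  newVAdj≡N[v] : ∀ {x} → x ≢ u → newVAdj A u v x ≡ inClosedN A v x
  newVAdj≡N[v] {x} x≢u rewrite ≢⇒==-false x≢u with x == v in x=v | A u x in ux | A v x in vx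
  ... | true  | true  | true  = refl
  ... | true  | true  | false = refl
  ... | true  | false | true  = refl
  ... | true  | false | false = contradiction (subst (λ w → A u w ≡ false) (==⇒≡ x=v) ux) (true≢false uv)
  ... | false | true  | true  = refl
  ... | false | true  | false = refl
  ... | false | false | true  = refl
  ... | false | false | false = refl

  shift-off-u : ∀ {x y} → x ≢ u → y ≢ u → B x y ≡ A x y
  shift-off-u {x} {y} x≢u y≢u with x == y
  ... | true  = refl
  ... | false rewrite ≢⇒==-false x≢u | ≢⇒==-false y≢u = refl

  shift-uˡ : ∀ {x} → x ≢ u → B u x ≡ inClosedN A v x
  shift-uˡ {x} x≢u = trans at-u (newVAdj≡N[v] x≢u)
    where
      at-u : B u x ≡ newVAdj A u v x
      at-u rewrite ≢⇒==-false (x≢u ∘ sym) | ==-refl u = refl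

  shift-uʳ : ∀ {x} → x ≢ u → B x u ≡ inClosedN A v x
  shift-uʳ {x} x≢u = trans at-u (newVAdj≡N[v] x≢u)
    where
      at-u : B x u ≡ newVAdj A u v x
      at-u rewrite ≢⇒==-false x≢u | ==-refl u = refl

  shift-simple : IsSimple B
  shift-simple = record { sym = B-sym ; irrfl = B-irrefl }
    where
      B-irrefl : ∀ x → B x x ≡ false
      B-irrefl x rewrite ==-refl x = A-irrefl x

      -- Splitting on toSum (x ≟ u) rather than x ≟ u keeps the tests x == u inside shift intact.
      B-sym : ∀ x y → B x y ≡ B y x
      B-sym x y with toSum (x ≟ u) | toSum (y ≟ u)
      ... | inj₁ refl | inj₁ refl = refl
      ... | inj₁ refl | inj₂ y≢u = trans (shift-uˡ y≢u) (sym (shift-uʳ y≢u))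
      ... | inj₂ x≢u  | inj₁ refl = trans (shift-uʳ x≢u) (sym (shift-uˡ x≢u))
      ... | inj₂ x≢u  | inj₂ y≢u = trans (shift-off-u x≢u y≢u) (trans (A-sym x y) (sym (shift-off-u y≢u x≢u)))

  open IsSimple shift-simple using () renaming (sym to B-sym; irrfl to B-irrefl)

  shift-twins : ∀ z → z ≢ u → z ≢ v → B u z ≡ B v z
  shift-twins z z≢u z≢v =
    trans (shift-uˡ z≢u) (trans (cong (_∨ A v z) (≢⇒==-false z≢v)) (sym (shift-off-u (u≢v ∘ sym) z≢u)))

  shift-agrees-avoiding-u : ∀ {M x y} → ¬ u ∈V M → x ∈V M → y ∈V M → A x y ≡ B x y
  shift-agrees-avoiding-u u∉M x∈ y∈ = sym (shift-off-u (λ { refl → u∉M x∈ }) (λ { refl → u∉M y∈ }))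

  shift-agrees-on : (P : Fin n → Set) → (∀ {y} → P y → y ≢ u → A u y ≡ inClosedN A v y) →
                    ∀ {x y} → P x → P y → A x y ≡ B x y
  shift-agrees-on P N[u]≡N[v] {x} {y} px py with toSum (x ≟ u) | toSum (y ≟ u)
  ... | inj₁ refl | inj₁ refl = trans (A-irrefl u) (sym (B-irrefl u))
  ... | inj₁ refl | inj₂ y≢u = trans (N[u]≡N[v] py y≢u) (sym (shift-uˡ y≢u))
  ... | inj₂ x≢u  | inj₁ refl = trans (A-sym x u) (trans (N[u]≡N[v] px x≢u) (sym (shift-uʳ x≢u)))
  ... | inj₂ x≢u  | inj₂ y≢u = sym (shift-off-u x≢u y≢u)

  covering-u-v⇒N[u]≡N[v] : ∀ {M} → IsInducedMatching A M → u ∈V M → v ∈V M →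
                            ∀ {y} → y ∈V M → y ≢ u → A u y ≡ inClosedN A v y
  covering-u-v⇒N[u]≡N[v] im u∈ v∈ {y} y∈ y≢u = true⇔true⇒≡ N[u]⊆N[v] N[v]⊆N[u]
    where
      open IsInducedMatching im

      N[u]⊆N[v] : A u y ≡ true → inClosedN A v y ≡ true
      N[u]⊆N[v] uy with refl ← adj-unique u∈ y∈ v∈ uy uv = cong (_∨ A v v) (==-refl v)

      N[v]⊆N[u] : inClosedN A v y ≡ true → A u y ≡ true
      N[v]⊆N[u] vy with ∨-true⁻ vy
      ... | inj₁ y=v = subst (λ w → A u w ≡ true) (sym (==⇒≡ y=v)) uv
      ... | inj₂ vy  = contradiction (adj-unique v∈ y∈ u∈ vy (trans (A-sym v u) uv)) y≢u

  shift-IM-covering-u-v : ∀ {M} → IsInducedMatching A M → u ∈V M → v ∈V M → IsInducedMatching B M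
  shift-IM-covering-u-v im u∈ v∈ = IM-transfer im (shift-agrees-on (_∈V _) (covering-u-v⇒N[u]≡N[v] im u∈ v∈))

  shift-extension-injective : ∀ {M₁ M₂ M′} → IsMaximalInducedMatching A M₁ → IsMaximalInducedMatching A M₂ →
                              u ∈V M₁ → v ∈V M₁ → u ∈V M₂ → v ∈V M₂ →
                              IsInducedMatching B M′ → M₁ ⊆ᴱ M′ → M₂ ⊆ᴱ M′ → M₁ ≡ M₂
  shift-extension-injective {M₁} {M₂} {M′} mim₁ mim₂ u∈₁ v∈₁ u∈₂ v∈₂ im′ M₁⊆M′ M₂⊆M′ =
    maximal-∪-IM⇒≡ mim₁ mim₂ (IM-transfer im∪ λ x∈ y∈ → sym (shift-agrees-on (_∈V M₁ ∪ᴱ M₂) N[u]≡N[v] x∈ y∈))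
    where
      im∪ : IsInducedMatching B (M₁ ∪ᴱ M₂)
      im∪ = IM-⊆ im′ (∪-⊆ᴱ M₁ M₂ {M′} M₁⊆M′ M₂⊆M′)
              (∪-mem-sym M₁ M₂ (IsInducedMatching.mem-sym (proj₁ mim₁)) (IsInducedMatching.mem-sym (proj₁ mim₂)))

      N[u]≡N[v] : ∀ {y} → y ∈V M₁ ∪ᴱ M₂ → y ≢ u → A u y ≡ inClosedN A v y
      N[u]≡N[v] y∈ = [ covering-u-v⇒N[u]≡N[v] (proj₁ mim₁) u∈₁ v∈₁ , covering-u-v⇒N[u]≡N[v] (proj₁ mim₂) u∈₂ v∈₂ ] (∪-∈V M₁ M₂ y∈)

  numMIMCoveringBoth-≤ : count (mimCoveringBoth A u v) (allEdgeSets n) ≤ count (mimCoveringBoth B u v) (allEdgeSets n)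
  numMIMCoveringBoth-≤ =
    count-≤-injection (mimCoveringBoth A u v) (mimCoveringBoth B u v) (allEdgeSets-unique n)
      (λ M p → proj₁ (extension M p)) (λ _ _ → allEdgeSets-complete _) extension-covers extension-injective
    where
      extension : ∀ M → mimCoveringBoth A u v M ≡ true → ∃ λ M* → IsMaximalInducedMatching B M* × M ⊆ᴱ M*
      extension M p = let mim , u∈ , v∈ = mimCoveringBoth⁻ A u v {M} p in
        maximal-extension B M (shift-IM-covering-u-v (proj₁ mim) u∈ v∈)

      extension-covers : ∀ M p → mimCoveringBoth B u v (proj₁ (extension M p)) ≡ true
      extension-covers M p = let _ , u∈ , v∈ = mimCoveringBoth⁻ A u v {M} p ; _ , mim* , M⊆M* = extension M p in
        mimCoveringBoth⁺ B u v mim* (∈V-mono M⊆M* u∈) (∈V-mono M⊆M* v∈)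

      extension-injective : ∀ M₁ M₂ p₁ p₂ → proj₁ (extension M₁ p₁) ≡ proj₁ (extension M₂ p₂) → M₁ ≡ M₂
      extension-injective M₁ M₂ p₁ p₂ same-extension =
        let mim₁ , u∈₁ , v∈₁ = mimCoveringBoth⁻ A u v {M₁} p₁ ; _ , (im* , _) , M₁⊆M* = extension M₁ p₁
            mim₂ , u∈₂ , v∈₂ = mimCoveringBoth⁻ A u v {M₂} p₂ ; _ , _ , M₂⊆M** = extension M₂ p₂
        in shift-extension-injective mim₁ mim₂ u∈₁ v∈₁ u∈₂ v∈₂ im* M₁⊆M*
             (subst (M₂ ⊆ᴱ_) (sym same-extension) M₂⊆M**)

  module _ (no-W₁-MIM : NoMIMInsideW₁∪W₄MeetingW₁ A u v) where

    shift-extension-avoids-u : ∀ {M M′} → IsMaximalInducedMatching A M → ¬ u ∈V M →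
                               IsInducedMatching B M′ → M ⊆ᴱ M′ → ¬ u ∈V M′
    shift-extension-avoids-u {M} {M′} mim@(im , _) u∉M im′ M⊆M′ (covered {y} muy) = dominated (toSum (y ≟ v))
      where
        open IsInducedMatching

        Buy : B u y ≡ true
        Buy = mem⇒adj im′ muy

        y≢u : y ≢ u
        y≢u y≡u = true≢false (subst (λ w → B u w ≡ true) y≡u Buy) (B-irrefl u)

        ≢u : ∀ {z} → z ∈V M → z ≢ u
        ≢u z∈ refl = u∉M z∈

        y-isolated : ∀ {z} → z ∈V M → A y z ≡ false
        y-isolated z∈ = ¬-not λ yz →
          ≢u z∈ (sym (adj-unique im′ (partner∈V im′ muy) (covered muy) (∈V-mono M⊆M′ z∈)
                                 (trans (B-sym y u) Buy) (trans (shift-off-u y≢u (≢u z∈)) yz)))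

        N[v]-avoided : ∀ {z} → z ∈V M → inClosedN A v z ≡ false
        N[v]-avoided z∈@(covered mzw) = ¬-not λ vz →
          let y≡z = adj-unique im′ (covered muy) (partner∈V im′ muy) (∈V-mono M⊆M′ z∈) Buy (trans (shift-uˡ (≢u z∈)) vz)
          in true≢false (mem⇒adj im mzw) (subst (λ w → A w _ ≡ false) y≡z (y-isolated (partner∈V im mzw)))

        inside-W₁∪W₄ : ∀ x → inV A M x ≡ true → W₁ A u v x ∨ W₄ A u v x ≡ true
        inside-W₁∪W₄ x x∈ rewrite N[v]-avoided (inV-true⁻ A M x x∈) | ≢⇒==-false (≢u (inV-true⁻ A M x x∈)) with A u x
        ... | true  = refl
        ... | false = refl

        dominated : y ≡ v ⊎ y ≢ v → ⊥
        dominated (inj₂ y≢v) = maximal⇒dominating simple mim vy (proj₂ ∘ ∨-false⁻ ∘ N[v]-avoided) y-isolated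
          where
            vy : A v y ≡ true
            vy = trans (sym (cong (_∨ A v y) (≢⇒==-false y≢v))) (trans (sym (shift-uˡ y≢u)) Buy)
        dominated (inj₁ y≡v) with any? (λ z → inV A M z ∧ A u z Bool.≟ true)
        ... | yes (z , z∈∧uz) = let z∈ , uz = ∧-true⁻ z∈∧uz in
          no-W₁-MIM M (isMaximalInducedMatching-true⁺ A M mim) inside-W₁∪W₄
            (z , z∈ , cong₂ _∧_ uz (cong not (N[v]-avoided (inV-true⁻ A M z z∈))))
        ... | no u-isolated =
          maximal⇒dominating simple mim uv
            (λ {z} z∈ → ¬-not λ uz → u-isolated (z , cong₂ _∧_ (inV-true⁺ A M z z∈) uz))
            (λ z∈ → subst (λ w → A w _ ≡ false) y≡v (y-isolated z∈))

    shift-MIM-avoiding-u : ∀ {M} → IsMaximalInducedMatching A M → ¬ u ∈V M → IsMaximalInducedMatching B M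
    shift-MIM-avoiding-u mim@(im , maximal) u∉M =
      IM-transfer im (shift-agrees-avoiding-u u∉M) ,
      λ im′ M⊆M′ → maximal (IM-transfer im′ λ x∈ y∈ →
        sym (shift-agrees-avoiding-u (shift-extension-avoids-u mim u∉M im′ M⊆M′) x∈ y∈)) M⊆M′

    numMIMAvoiding-≤ : count (mimAvoiding A u) (allEdgeSets n) ≤ count (mimAvoiding B u) (allEdgeSets n)
    numMIMAvoiding-≤ =
      count-≤-injection (mimAvoiding A u) (mimAvoiding B u) (allEdgeSets-unique n) (λ M _ → M)
        (λ M _ → allEdgeSets-complete M)
        (λ M p → let mim , u∉ = mimAvoiding⁻ A u {M} p in mimAvoiding⁺ B u (shift-MIM-avoiding-u mim u∉) u∉)
        (λ _ _ _ _ → id)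

    numMIMCoveringOnly-≤ : count (mimCoveringOnly A v u) (allEdgeSets n) ≤ count (mimCoveringOnly B u v) (allEdgeSets n)
    numMIMCoveringOnly-≤ =
      count-≤-injection (mimCoveringOnly A v u) (mimCoveringOnly B u v) (allEdgeSets-unique n) (λ M _ → relabel τ M)
        (λ _ _ → allEdgeSets-complete _) swapped-covers
        (λ M₁ M₂ _ _ same → trans (sym (relabel-involutive τ-involutive M₁))
                              (trans (cong (relabel τ) same) (relabel-involutive τ-involutive M₂)))
      where
        τ : Fin n → Fin n
        τ = transpose u v

        τ-involutive : ∀ x → τ (τ x) ≡ x
        τ-involutive = transpose-involutive u v

        swapped-covers : ∀ M p → mimCoveringOnly B u v (relabel τ M) ≡ true
        swapped-covers M p =
          let mim , v∈ , u∉ = mimCoveringOnly⁻ A v u {M} p in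
          mimCoveringOnly⁺ B u v
            (relabel-MIM τ-involutive (twins⇒transpose-automorphism u v shift-simple shift-twins)
              (shift-MIM-avoiding-u mim u∉))
            (∈V-relabel⁺ τ-involutive (subst (_∈V M) (sym (transpose-matchˡ u v)) v∈))
            (u∉ ∘ subst (_∈V M) (transpose-matchʳ u v) ∘ ∈V-relabel⁻ τ-involutive)

    numMIM-shift-lower-bound :
      (count (mimCoveringBoth A u v) (allEdgeSets n) + count (mimCoveringOnly A v u) (allEdgeSets n))
        + count (mimAvoiding A u) (allEdgeSets n) ≤ numMIM B
    numMIM-shift-lower-bound = begin
      (count (mimCoveringBoth A u v) L + count (mimCoveringOnly A v u) L) + count (mimAvoiding A u) L
        ≤⟨ ℕ.+-mono-≤ (ℕ.+-mono-≤ numMIMCoveringBoth-≤ numMIMCoveringOnly-≤) numMIMAvoiding-≤ ⟩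
      (count (mimCoveringBoth B u v) L + count (mimCoveringOnly B u v) L) + count (mimAvoiding B u) L
        ≡⟨ numMIM-split B u v ⟨
      numMIM B ∎
      where
        open ℕ.≤-Reasoning
        L = allEdgeSets n

half-bound : ∀ {m a b} → m + m ≤ a + b → a ≥ m ⊎ b ≥ m
half-bound {m} {a} {b} m+m≤a+b with m ≤? a | m ≤? b
... | yes m≤a | _       = inj₁ m≤a
... | no _    | yes m≤b = inj₂ m≤b
... | no m≰a  | no m≰b  = contradiction m+m≤a+b (ℕ.<⇒≱ (ℕ.+-mono-< (ℕ.≰⇒> m≰a) (ℕ.≰⇒> m≰b)))

lemma2p1 : {n : ℕ} (A : Adj n) → IsSimple A → (u v : Fin n) → A u v ≡ true →
    (∀ (M : EdgeSet n) → isMaximalInducedMatching A M ≡ true →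
       (∀ x → inV A M x ≡ true →
          (A u x ∧ not (inClosedN A v x)) ∨ not (inClosedN A u x ∨ inClosedN A v x) ≡ true) →
       ∃ (λ x → inV A M x ≡ true × (A u x ∧ not (inClosedN A v x)) ≡ true) → ⊥) →
    (∀ (M : EdgeSet n) → isMaximalInducedMatching A M ≡ true →
       (∀ x → inV A M x ≡ true →
          (A v x ∧ not (inClosedN A u x)) ∨ not (inClosedN A u x ∨ inClosedN A v x) ≡ true) →
       ∃ (λ x → inV A M x ≡ true × (A v x ∧ not (inClosedN A u x)) ≡ true) → ⊥) →
    (numMIM (shift A u v) ≥ numMIM A) ⊎ (numMIM (shift A v u) ≥ numMIM A)
lemma2p1 {n} A simple u v uv no-W₁-MIM no-W₃-MIM = half-bound (begin
  numMIM A + numMIM A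
    ≡⟨ cong₂ _+_ (numMIM-split A u v) (numMIM-split A v u) ⟩
  (both u v + only u v + avoiding u) + (both v u + only v u + avoiding v)
    ≡⟨ rearrange (both u v) (only u v) (avoiding u) (both v u) (only v u) (avoiding v) ⟩
  (both u v + only v u + avoiding u) + (both v u + only u v + avoiding v)
    ≤⟨ ℕ.+-mono-≤ (Shift.numMIM-shift-lower-bound A simple u v uv no-W₁-MIM)
                  (Shift.numMIM-shift-lower-bound A simple v u (trans (IsSimple.sym simple v u) uv) no-W₃-MIM′) ⟩
  numMIM (shift A u v) + numMIM (shift A v u) ∎)
  where
    open ℕ.≤-Reasoning

    both only : Fin n → Fin n → ℕ
    both x y = count (mimCoveringBoth A x y) (allEdgeSets n)
    only x y = count (mimCoveringOnly A x y) (allEdgeSets n)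

    avoiding : Fin n → ℕ
    avoiding x = count (mimAvoiding A x) (allEdgeSets n)

    rearrange : ∀ b₁ o₁ a₁ b₂ o₂ a₂ → (b₁ + o₁ + a₁) + (b₂ + o₂ + a₂) ≡ (b₁ + o₂ + a₁) + (b₂ + o₁ + a₂)
    rearrange = solve-∀

    no-W₃-MIM′ : NoMIMInsideW₁∪W₄MeetingW₁ A v u
    no-W₃-MIM′ M mim inside = no-W₃-MIM M mim λ x x∈ →
      subst (λ b → W₁ A v u x ∨ not b ≡ true) (∨-comm (inClosedN A v x) (inClosedN A u x)) (inside x x∈)
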